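{- Any ETL frame $\langle E,H,\sim\rangle$ (with $\sim$ an arbitrary binary relation on $H$) that has $\mathsf{PR_{ee}}$ has a transitive and Euclidean accessibility relation $\sim$.
   Context: Fix a finite set $E$ of events; histories are finite sequences of events, $\epsilon$ is the empty history. A protocol $H$ is a finite prefix-closed set of histories. An ETL frame is $\langle E,H,\sim\rangle$ with $\sim\subseteq H\times H$ arbitrary. $[h]_\sim=\{h':h\sim h'\}$. For a history $e_1\dots e_\ell$, $\mathrm{EE}(e_1\dots e_\ell)$ is the sequence $[\epsilon]_\sim,[e_1]_\sim,[e_1e_2]_\sim,\dots,[e_1\dots e_\ell]_\sim$; $\mathrm{EE}(h)\approx\mathrm{EE}(h')$ iff the two sequences coincide after collapsing each block of consecutive identical sets into one. The frame has $\mathsf{PR_{ee}}$ iff $h\sim h'$ implies $\mathrm{EE}(h)\approx\mathrm{EE}(h')$. Euclidean: $h\sim h'$ and $h\sim h''$ imply $h'\sim h''$. -}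

module Defs where

open import Level using (0ℓ)
open import Data.Nat using (ℕ)
open import Data.Fin using (Fin)
open import Data.List using (List; []; _∷_; _++_; inits; map)
open import Data.List.Membership.Propositional using (_∈_)
open import Data.List.Relation.Binary.Pointwise using (Pointwise)
open import Data.Product using (Σ; _×_; ∃-syntax)
open import Relation.Nullary using (¬_)
open import Function.Bundles using (_⇔_)

-- Events: a finite set, taken to be Fin n.  Histories: finite sequences of events.
History : ℕ → Set
History n = List (Fin n)

HSet : ℕ → Set₁
HSet n = History n → Set

_≐_ : ∀ {n} → HSet n → HSet n → Set
A ≐ B = ∀ h → A h ⇔ B h

record Protocol (n : ℕ) : Set₁ where
  field
    H            : HSet n
    finite       : Σ (List (History n)) (λ l → ∀ h → H h ⇔ (h ∈ l))
    prefixClosed : ∀ h h' → H (h ++ h') → H h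

record ETLFrame (n : ℕ) : Set₁ where
  field
    protocol : Protocol n
    _∼_      : History n → History n → Set
    ∼⊆H×H    : ∀ {h h'} → h ∼ h' → Protocol.H protocol h × Protocol.H protocol h'
  open Protocol protocol public

module _ {n : ℕ} (F : ETLFrame n) where
  open ETLFrame F

  cls : History n → HSet n
  cls h h' = h ∼ h'

  EE : History n → List (HSet n)
  EE h = map cls (inits h)

  -- Collapse s c : c is s with every block of consecutive identical sets collapsed to one.
  data Collapse : List (HSet n) → List (HSet n) → Set₁ where
    c-nil  : Collapse [] []
    c-one  : ∀ x → Collapse (x ∷ []) (x ∷ [])
    c-same : ∀ {x y xs ys} → x ≐ y → Collapse (y ∷ xs) ys → Collapse (x ∷ y ∷ xs) ys
    c-diff : ∀ {x y xs ys} → ¬ (x ≐ y) → Collapse (y ∷ xs) ys → Collapse (x ∷ y ∷ xs) (x ∷ ys)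

  _≈EE_ : History n → History n → Set₁
  h ≈EE h' = ∃[ c ] ∃[ c' ] (Collapse (EE h) c × Collapse (EE h') c' × Pointwise _≐_ c c')

  PRee : Set₁
  PRee = ∀ {h h'} → h ∼ h' → h ≈EE h'

  Transitive∼ : Set
  Transitive∼ = ∀ {h h' h''} → h ∼ h' → h' ∼ h'' → h ∼ h''

  Euclidean∼ : Set
  Euclidean∼ = ∀ {h h' h''} → h ∼ h' → h ∼ h'' → h' ∼ h''

-- The class [h]∼ is the last entry of EE(h), and collapsing blocks of identical
-- sets keeps the last entry up to ≐.  So PR_ee forces h ∼ h' ⇒ [h]∼ ≐ [h']∼,
-- from which transitivity and Euclideanness are immediate.
module Submission where

open import Defs
open import Data.Nat using (ℕ)
open import Data.Product using (_×_; _,_)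
open import Data.List using (List; []; _∷_; map; inits; last)
import Data.List.Base as List
open import Data.List.Properties using (last-map)
open import Data.List.Relation.Binary.Pointwise using ([]; _∷_)
  renaming (Pointwise to ListPointwise)
import Data.Maybe as Maybe
open import Data.Maybe.Relation.Binary.Pointwise using (just; nothing; drop-just)
  renaming (Pointwise to MaybePointwise; setoid to maybeSetoid)
open import Data.Empty using (⊥-elim)
open import Function.Bundles using (Equivalence)
import Function.Properties.Equivalence as ⇔
open import Relation.Binary.Bundles using (Setoid)
open import Relation.Binary.Core using (REL)
open import Relation.Binary.PropositionalEquality using (_≡_; refl; cong; trans)
open import Relation.Nullary using (¬_)

last-tail-inits : ∀ {a} {A : Set a} (x : A) (xs : List A) →
                  last (List.Inits.tail (x ∷ xs)) ≡ Maybe.just (x ∷ xs)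
last-tail-inits x []       = refl
last-tail-inits x (y ∷ ys) = trans (last-map (x ∷_) (List.Inits.tail (y ∷ ys)))
                                   (cong (Maybe.map (x ∷_)) (last-tail-inits y ys))

last-inits : ∀ {a} {A : Set a} (xs : List A) → last (inits xs) ≡ Maybe.just xs
last-inits []       = refl
last-inits (x ∷ xs) = last-tail-inits x xs

last-pointwise : ∀ {a b r} {A : Set a} {B : Set b} {R : REL A B r} {xs ys} →
                 ListPointwise R xs ys → MaybePointwise R (last xs) (last ys)
last-pointwise []               = nothing
last-pointwise (r ∷ [])         = just r
last-pointwise (_ ∷ rs@(_ ∷ _)) = last-pointwise rs

≐-setoid : ℕ → Setoid _ _
≐-setoid n = record
  { Carrier       = HSet n
  ; _≈_           = _≐_
  ; isEquivalence = record
    { refl  = λ _ → ⇔.refl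
    ; sym   = λ A≐B h → ⇔.sym (A≐B h)
    ; trans = λ A≐B B≐C h → ⇔.trans (A≐B h) (B≐C h)
    }
  }

module _ {n : ℕ} (F : ETLFrame n) where
  open ETLFrame F
  open Setoid (≐-setoid n) using () renaming (refl to ≐-refl)

  last-EE : ∀ h → last (EE F h) ≡ Maybe.just (cls F h)
  last-EE h = trans (last-map (cls F) (inits h)) (cong (Maybe.map (cls F)) (last-inits h))

  collapse-nonempty : ∀ {x xs} → ¬ Collapse F (x ∷ xs) []
  collapse-nonempty (c-same _ c) = collapse-nonempty c

  last-collapse : ∀ {xs ys} → Collapse F xs ys → MaybePointwise _≐_ (last xs) (last ys)
  last-collapse c-nil                     = nothing
  last-collapse (c-one _)                 = just ≐-refl
  last-collapse (c-same _ c)              = last-collapse c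
  last-collapse (c-diff {ys = []} _ c)    = ⊥-elim (collapse-nonempty c)
  last-collapse (c-diff {ys = _ ∷ _} _ c) = last-collapse c

  ≈EE⇒cls-≐ : ∀ {h h'} → _≈EE_ F h h' → cls F h ≐ cls F h'
  ≈EE⇒cls-≐ {h} {h'} (c , c' , collapse , collapse' , c≐c') = drop-just (begin
    Maybe.just (cls F h)   ≡⟨ last-EE h ⟨
    last (EE F h)          ≈⟨ last-collapse collapse ⟩
    last c                 ≈⟨ last-pointwise c≐c' ⟩
    last c'                ≈⟨ last-collapse collapse' ⟨
    last (EE F h')         ≡⟨ last-EE h' ⟩
    Maybe.just (cls F h')  ∎)
    where open import Relation.Binary.Reasoning.Setoid (maybeSetoid (≐-setoid n))

  PRee⇒cls-≐ : PRee F → ∀ {h h'} → h ∼ h' → cls F h ≐ cls F h'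
  PRee⇒cls-≐ pr h∼h' = ≈EE⇒cls-≐ (pr h∼h')

proposition6 : ∀ {n : ℕ} (F : ETLFrame n) → PRee F → Transitive∼ F × Euclidean∼ F
proposition6 F pr =
  (λ {_} {_} {h''} h∼h' h'∼h'' → from (PRee⇒cls-≐ F pr h∼h' h'') h'∼h'') ,
  (λ {_} {_} {h''} h∼h' h∼h''  → to   (PRee⇒cls-≐ F pr h∼h' h'') h∼h'')
  where open Equivalence
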